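{- Let $\mathfrak{S}$ be a board, $I,J\subseteq\mathfrak{S}$, and let $\mathcal{F}=(\mathfrak{g}_1,\dots,\mathfrak{g}_k)$ be a succession of legal moves going from $I$ to $J$. Let $A,A'\in\mathfrak{S}$ satisfy $\operatorname{Height}(A,A',I)=\infty$. Then $$\mathfrak{p}(A,\mathcal{F})+\mathfrak{p}(A',\mathcal{F})-\sum_{\mathfrak{g}:\ \mathfrak{g}(A)\mathfrak{g}(A')\neq0}x(\mathfrak{g})\le|I|-|J|.$$
   Context: A board $\mathfrak{S}$ is a finite subset of $\mathbb{Z}^2$; $[P]$ is the function equal to $1$ at $P$ and $0$ elsewhere. Moves $\mathscr{D}(\mathfrak{S})$ are the functions $\mathfrak{g}=[P]+[Q]-[R]$ with $P,Q,R\in\mathfrak{S}$, $Q=P+v$, $R=P+2v$, $v\in\{(\pm1,0),(0,\pm1)\}$. A position is a subset of $\mathfrak{S}$; a legal move $[P]+[Q]-[R]$ goes from $K$ to $(K\setminus\{P,Q\})\cup\{R\}$ when $P,Q\in K$, $R\notin K$. For the succession $\mathcal{F}$, let $K_0=I,K_1,\dots,K_k=J$ be the successive positions ($\mathfrak{g}_i$ goes from $K_{i-1}$ to $K_i$). Set $x(\mathfrak{g})=\#\{i:\mathfrak{g}_i=\mathfrak{g}\}$ and, for $A\in\mathfrak{S}$, $y_{\mathfrak{g}}(A)=\#\{i:\mathfrak{g}_i=\mathfrak{g},\ \mathfrak{g}(A)=0,\ A\in K_{i-1}\}$, and $\mathfrak{p}(A,\mathcal{F})=\sum_{\mathfrak{g}}y_{\mathfrak{g}}(A)+\sum_{\mathfrak{g}:\,\mathfrak{g}(A)\neq0}x(\mathfrak{g})$.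 $\operatorname{Height}(A,A',I)$ is the minimal number of legal moves (possibly zero) needed, starting from $I$, to reach a position containing both $A$ and $A'$, and is $\infty$ if no such sequence exists. -}

module Defs where

open import Data.Bool using (Bool; true; false; if_then_else_; _∧_)
open import Data.Nat using (ℕ; zero; suc)
import Data.Nat as ℕ
open import Data.Integer using (ℤ; +_; _-_; _≤_) renaming (_+_ to _+ℤ_)
import Data.Integer as ℤ
open import Data.Product using (_×_; _,_; proj₁; proj₂; Σ)
open import Data.Product.Properties using (≡-dec)
open import Data.List using (List; []; _∷_; length; filter; concatMap; map)
open import Data.Nat.ListAction using (sum)
open import Data.List.Relation.Unary.Unique.Propositional using (Unique)
open import Data.List.Membership.Propositional using (_∈_)
open import Data.Empty using (⊥)
open import Relation.Nullary using (Dec; yes; no; ¬_)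
open import Relation.Nullary.Decidable using (⌊_⌋; _×-dec_)
open import Relation.Binary.PropositionalEquality using (_≡_; refl)
open import Relation.Binary.Definitions using (DecidableEquality)

Point : Set
Point = ℤ × ℤ

_≟P_ : DecidableEquality Point
_≟P_ = ≡-dec ℤ._≟_ ℤ._≟_

_+P_ : Point → Point → Point
(a , b) +P (c , d) = (a +ℤ c , b +ℤ d)

record Board : Set where
  field
    cells  : List Point
    unique : Unique cells
open Board public

-- A position: a subset of ℤ² (by its characteristic function); we require
-- positions on 𝔖 to be contained in the board (see _⊆B_).
Position : Set
Position = Point → Bool

_∈K_ : Point → Position → Set
A ∈K K = K A ≡ true

_⊆B_ : Position → Board → Set
K ⊆B S = ∀ A → A ∈K K → A ∈ cells S

card : Board → Position → ℕ
card S K = length (filter (λ A → K A Data.Bool.≟ true) (cells S))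

data Dir : Set where
  right left up down : Dir

dirVec : Dir → Point
dirVec right = (+ 1 , + 0)
dirVec left  = (ℤ.- (+ 1) , + 0)
dirVec up    = (+ 0 , + 1)
dirVec down  = (+ 0 , ℤ.- (+ 1))

_≟D_ : DecidableEquality Dir
right ≟D right = yes refl
left  ≟D left  = yes refl
up    ≟D up    = yes refl
down  ≟D down  = yes refl
right ≟D left  = no λ ()
right ≟D up    = no λ ()
right ≟D down  = no λ ()
left  ≟D right = no λ ()
left  ≟D up    = no λ ()
left  ≟D down  = no λ ()
up    ≟D right = no λ ()
up    ≟D left  = no λ ()
up    ≟D down  = no λ ()
down  ≟D right = no λ ()
down  ≟D left  = no λ ()
down  ≟D up    = no λ ()

-- A move 𝔤 = [P] + [Q] - [R] with Q = P + v, R = P + 2v is determined by (P, v);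
-- distinct (P, v) give distinct functions 𝔤, so equality of moves is
-- equality of these pairs.
Move : Set
Move = Point × Dir

_≟M_ : DecidableEquality Move
_≟M_ = ≡-dec _≟P_ _≟D_

mP mQ mR : Move → Point
mP (P , d) = P
mQ (P , d) = P +P dirVec d
mR (P , d) = (P +P dirVec d) +P dirVec d

ind : Point → Point → ℤ
ind P A = if ⌊ P ≟P A ⌋ then + 1 else + 0

mval : Move → Point → ℤ
mval g A = (ind (mP g) A +ℤ ind (mQ g) A) - ind (mR g) A

InD : Board → Move → Set
InD S g = (mP g ∈ cells S) × (mQ g ∈ cells S) × (mR g ∈ cells S)

open import Data.List.Membership.DecPropositional _≟P_ using (_∈?_)

inD? : (S : Board) → (g : Move) → Dec (InD S g)
inD? S g = (mP g ∈? cells S) ×-dec ((mQ g ∈? cells S) ×-dec (mR g ∈? cells S))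

allDirs : List Dir
allDirs = right ∷ left ∷ up ∷ down ∷ []

-- enumeration of 𝒟(𝔖) (duplicate-free since the board is)
movesOf : Board → List Move
movesOf S = filter (inD? S) (concatMap (λ P → map (λ d → (P , d)) allDirs) (cells S))

apply : Move → Position → Position
apply g K A =
  if ⌊ mR g ≟P A ⌋ then true
  else if ⌊ mP g ≟P A ⌋ then false
  else if ⌊ mQ g ≟P A ⌋ then false
  else K A

LegalMove : Board → Position → Move → Set
LegalMove S K g = InD S g × (mP g ∈K K) × (mQ g ∈K K) × (K (mR g) ≡ false)

data Succession (S : Board) : Position → List Move → Position → Set where
  done : ∀ {K} → Succession S K [] K
  step : ∀ {K g gs J} → LegalMove S K g → Succession S (apply g K) gs J →
         Succession S K (g ∷ gs) J

xcount : List Move → Move → ℕ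
xcount [] g = 0
xcount (h ∷ hs) g = (if ⌊ h ≟M g ⌋ then 1 else 0) ℕ.+ xcount hs g

-- y_𝔤(A) = #{i : 𝔤ᵢ = 𝔤, 𝔤(A) = 0, A ∈ K_{i-1}}, where K₀ = starting position
ycount : Position → List Move → Move → Point → ℕ
ycount K [] g A = 0
ycount K (h ∷ hs) g A =
  (if ⌊ h ≟M g ⌋ ∧ ⌊ mval g A ℤ.≟ + 0 ⌋ ∧ K A then 1 else 0) ℕ.+ ycount (apply h K) hs g A

sumD : Board → (Move → ℕ) → ℕ
sumD S f = sum (map f (movesOf S))

nonzero : ℤ → Bool
nonzero z = if ⌊ z ℤ.≟ + 0 ⌋ then false else true

pfun : Board → Position → List Move → Point → ℕ
pfun S I F A =
  sumD S (λ g → ycount I F g A)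
  ℕ.+ sumD S (λ g → if nonzero (mval g A) then xcount F g else 0)

crossSum : Board → List Move → Point → Point → ℕ
crossSum S F A A' = sumD S (λ g → if nonzero (mval g A ℤ.* mval g A') then xcount F g else 0)

-- Height(A, A', I) = ∞ : no (possibly empty) sequence of legal moves from I
-- reaches a position containing both A and A'.

HeightInfinite : Board → Point → Point → Position → Set
HeightInfinite S A A' I =
  ∀ (F : List Move) (K : Position) → Succession S I F K → ¬ ((A ∈K K) × (A' ∈K K))

module Submission where

-- Write t(𝔤, K, X) = [𝔤(X) = 0 ∧ X ∈ K] + [𝔤(X) ≠ 0] for
-- the amount a single move 𝔤, played at position K, adds to 𝔭(X, ·).  Since
-- every move of 𝒟(𝔖) occurs exactly once in the enumeration of the board's
-- moves, playing 𝔤 first adds exactly t(𝔤, K, X) to 𝔭(X, ·), adds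
-- [𝔤(A)𝔤(A') ≠ 0] to the cross sum, and lowers |K| by exactly one.  The heart
-- of the argument is the one-move inequality
--     t(𝔤, K, A) + t(𝔤, K, A') ≤ [𝔤(A)𝔤(A') ≠ 0] + 1,
-- which holds because Height(A, A', K) = ∞: A and A' are never both occupied
-- in K, nor in the position reached by 𝔤 (this matters when 𝔤 lands on one
-- of them without touching the other).  Summing it along the succession
-- (Height stays ∞ after every move) gives the theorem.

open import Defs
open import Data.Nat using (ℕ; suc)
open import Data.Integer using (+_; _-_; _≤_)
open import Data.List using (List)
open import Data.List.Membership.Propositional using (_∈_)

import Data.Nat as N
import Data.Nat.Properties as NP
import Data.Integer as Z
import Data.Integer.Properties as ZP
import Data.Integer.Solver as ZS
import Data.Bool as B
open import Data.Bool using (Bool; true; false; if_then_else_; _∧_)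
open import Data.Bool.Properties using (¬-not)
open import Data.List using ([]; _∷_; _++_; map; filter; concatMap; length; cartesianProduct)
open import Data.List.Properties using (map-cong)
open import Data.Nat.ListAction using (sum)
open import Data.Product using (_×_; _,_; proj₁; proj₂)
import Data.Product as Product
open import Data.Sum using (_⊎_; inj₁; inj₂)
open import Data.Empty using (⊥-elim)
open import Function using (_∘_)
open import Relation.Nullary using (Dec; yes; no; ¬_)
open import Relation.Nullary.Decidable using (⌊_⌋)
open import Relation.Binary.PropositionalEquality
open import Data.List.Relation.Unary.All as All using (All; []; _∷_)
open import Data.List.Relation.Unary.Any using (here; there)
open import Data.List.Relation.Unary.AllPairs using ([]; _∷_)
open import Data.List.Relation.Unary.Unique.Propositional using (Unique)
open import Data.List.Relation.Unary.Unique.Propositional.Properties using (filter⁺; cartesianProduct⁺)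
open import Data.List.Membership.Propositional.Properties using (∈-filter⁺; ∈-cartesianProduct⁺)
open import Algebra.Properties.CommutativeSemigroup NP.+-commutativeSemigroup using (interchange)
open import Algebra.Bundles using (AbelianGroup)
open import Algebra.Properties.Group (AbelianGroup.group ZP.+-0-abelianGroup) using (identityʳ-unique)

bit : Bool → ℕ
bit b = if b then 1 else 0

sum-map-+ : ∀ {X : Set} (f g : X → ℕ) (xs : List X) →
  sum (map (λ x → f x N.+ g x) xs) ≡ sum (map f xs) N.+ sum (map g xs)
sum-map-+ f g [] = refl
sum-map-+ f g (x ∷ xs) = begin
  (f x N.+ g x) N.+ sum (map (λ x → f x N.+ g x) xs)
    ≡⟨ cong ((f x N.+ g x) N.+_) (sum-map-+ f g xs) ⟩
  (f x N.+ g x) N.+ (sum (map f xs) N.+ sum (map g xs))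
    ≡⟨ interchange (f x) (g x) _ _ ⟩
  (f x N.+ sum (map f xs)) N.+ (g x N.+ sum (map g xs)) ∎
  where open ≡-Reasoning

sum-map-zero : ∀ {X : Set} (f : X → ℕ) {xs : List X} → All (λ x → f x ≡ 0) xs →
  sum (map f xs) ≡ 0
sum-map-zero f [] = refl
sum-map-zero f (fx≡0 ∷ rest) rewrite fx≡0 = sum-map-zero f rest

sum-map-supported : ∀ {X : Set} {x : X} {xs : List X} (f : X → ℕ) →
  Unique xs → x ∈ xs → (∀ y → x ≢ y → f y ≡ 0) → sum (map f xs) ≡ f x
sum-map-supported {x = x} f (x∉ys ∷ _) (here refl) off =
  trans (cong (f x N.+_) (sum-map-zero f (All.map (off _) x∉ys))) (NP.+-identityʳ (f x))
sum-map-supported {x = x} f (y∉ys ∷ ys-unique) (there x∈ys) off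
  rewrite off _ (λ x≡y → All.lookup y∉ys x∈ys (sym x≡y)) =
  sum-map-supported f ys-unique x∈ys off

origin : Point
origin = (+ 0 , + 0)

+P-assoc : ∀ P v w → (P +P v) +P w ≡ P +P (v +P w)
+P-assoc (a , b) (c , d) (e , f) = cong₂ _,_ (ZP.+-assoc a c e) (ZP.+-assoc b d f)

+P-fixed : ∀ P v → P +P v ≡ P → v ≡ origin
+P-fixed (a , b) (c , d) eq =
  cong₂ _,_ (identityʳ-unique a c (cong proj₁ eq)) (identityʳ-unique b d (cong proj₂ eq))

dirVec≢origin : ∀ d → dirVec d ≢ origin
dirVec≢origin right ()
dirVec≢origin left ()
dirVec≢origin up ()
dirVec≢origin down ()

double-dirVec≢origin : ∀ d → dirVec d +P dirVec d ≢ origin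
double-dirVec≢origin right ()
double-dirVec≢origin left ()
double-dirVec≢origin up ()
double-dirVec≢origin down ()

P≢Q : ∀ g → mP g ≢ mQ g
P≢Q (P , d) P≡Q = dirVec≢origin d (+P-fixed P (dirVec d) (sym P≡Q))

Q≢R : ∀ g → mQ g ≢ mR g
Q≢R (P , d) = P≢Q (P +P dirVec d , d)

P≢R : ∀ g → mP g ≢ mR g
P≢R (P , d) P≡R =
  double-dirVec≢origin d (+P-fixed P _ (trans (sym (+P-assoc P _ _)) (sym P≡R)))

Touches : Move → Point → Set
Touches g X = mP g ≡ X ⊎ mQ g ≡ X ⊎ mR g ≡ X

nonzero⇒touches : ∀ g X → mval g X ≢ + 0 → Touches g X
nonzero⇒touches g X nz with mP g ≟P X | mQ g ≟P X | mR g ≟P X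
... | yes p | _     | _     = inj₁ p
... | no _  | yes q | _     = inj₂ (inj₁ q)
... | no _  | no _  | yes r = inj₂ (inj₂ r)
... | no _  | no _  | no _  = ⊥-elim (nz refl)

-- A cell where 𝔤 vanishes is left unchanged by 𝔤; this needs P, Q, R distinct,
-- since otherwise the contributions ±1 could cancel.
zero⇒unchanged : ∀ g K Y → mval g Y ≡ + 0 → apply g K Y ≡ K Y
zero⇒unchanged g K Y with mR g ≟P Y | mP g ≟P Y | mQ g ≟P Y
... | yes r | yes p | _     = ⊥-elim (P≢R g (trans p (sym r)))
... | yes r | no _  | yes q = ⊥-elim (Q≢R g (trans q (sym r)))
... | yes _ | no _  | no _  = λ ()
... | no _  | yes p | yes q = ⊥-elim (P≢Q g (trans p (sym q)))
... | no _  | yes _ | no _  = λ ()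
... | no _  | no _  | yes _ = λ ()
... | no _  | no _  | no _  = λ _ → refl

landing-occupied : ∀ g K → apply g K (mR g) ≡ true
landing-occupied g K with mR g ≟P mR g
... | yes _ = refl
... | no ne = ⊥-elim (ne refl)

indicator : Point → Point → ℕ
indicator X c = bit ⌊ X ≟P c ⌋

indicator-off : ∀ X c → X ≢ c → indicator X c ≡ 0
indicator-off X c X≢c with X ≟P c
... | yes X≡c = ⊥-elim (X≢c X≡c)
... | no _    = refl

indicator-at : ∀ X → indicator X X ≡ 1
indicator-at X with X ≟P X
... | yes _ = refl
... | no ne = ⊥-elim (ne refl)

-- Pointwise form of "a move removes P and Q and adds R".
apply-pointwise : ∀ g K → K (mP g) ≡ true → K (mQ g) ≡ true → K (mR g) ≡ false →
  ∀ c → bit (apply g K c) N.+ indicator (mP g) c N.+ indicator (mQ g) c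
        ≡ bit (K c) N.+ indicator (mR g) c
apply-pointwise g K kP kQ kR c with mR g ≟P c | mP g ≟P c | mQ g ≟P c
... | yes r    | yes p | _     = ⊥-elim (P≢R g (trans p (sym r)))
... | yes r    | no _  | yes q = ⊥-elim (Q≢R g (trans q (sym r)))
... | yes refl | no _  | no _  rewrite kR = refl
... | no _     | yes p | yes q = ⊥-elim (P≢Q g (trans p (sym q)))
... | no _     | yes refl | no _ rewrite kP = refl
... | no _     | no _  | yes refl rewrite kQ = refl
... | no _     | no _  | no _  = NP.+-identityʳ _

card-as-sum : ∀ (K : Position) (cs : List Point) →
  length (filter (λ A → K A B.≟ true) cs) ≡ sum (map (λ A → bit (K A)) cs)
card-as-sum K [] = refl
card-as-sum K (c ∷ cs) with K c
... | true  = cong suc (card-as-sum K cs)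
... | false = card-as-sum K cs

sum-indicator : ∀ S {X} → X ∈ cells S → sum (map (indicator X) (cells S)) ≡ 1
sum-indicator S {X} X∈S =
  trans (sum-map-supported (indicator X) (unique S) X∈S (indicator-off X)) (indicator-at X)

-- Summing apply-pointwise over the board, where P, Q, R each occur once.
card-step : ∀ S K g → LegalMove S K g → card S (apply g K) N.+ 1 ≡ card S K
card-step S K g ((P∈S , Q∈S , R∈S) , kP , kQ , kR) =
  NP.+-cancelʳ-≡ 1 _ _ (begin
    card S (apply g K) N.+ 1 N.+ 1
      ≡⟨ cong₂ (λ m n → card S (apply g K) N.+ m N.+ n)
               (sym (sum-indicator S P∈S)) (sym (sum-indicator S Q∈S)) ⟩
    card S (apply g K) N.+ Σ (indicator (mP g)) N.+ Σ (indicator (mQ g))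
      ≡⟨ cong (λ n → n N.+ Σ (indicator (mP g)) N.+ Σ (indicator (mQ g)))
              (card-as-sum (apply g K) (cells S)) ⟩
    Σ (λ c → bit (apply g K c)) N.+ Σ (indicator (mP g)) N.+ Σ (indicator (mQ g))
      ≡⟨ cong (N._+ Σ (indicator (mQ g))) (sym (sum-map-+ _ _ (cells S))) ⟩
    Σ (λ c → bit (apply g K c) N.+ indicator (mP g) c) N.+ Σ (indicator (mQ g))
      ≡⟨ sym (sum-map-+ _ _ (cells S)) ⟩
    Σ (λ c → bit (apply g K c) N.+ indicator (mP g) c N.+ indicator (mQ g) c)
      ≡⟨ cong sum (map-cong (apply-pointwise g K kP kQ kR) (cells S)) ⟩
    Σ (λ c → bit (K c) N.+ indicator (mR g) c)
      ≡⟨ sum-map-+ _ _ (cells S) ⟩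
    Σ (λ c → bit (K c)) N.+ Σ (indicator (mR g))
      ≡⟨ cong₂ N._+_ (sym (card-as-sum K (cells S))) (sum-indicator S R∈S) ⟩
    card S K N.+ 1 ∎)
  where
  open ≡-Reasoning
  Σ : (Point → ℕ) → ℕ
  Σ f = sum (map f (cells S))

allDirs-unique : Unique allDirs
allDirs-unique = ((λ ()) ∷ (λ ()) ∷ (λ ()) ∷ [])
               ∷ ((λ ()) ∷ (λ ()) ∷ [])
               ∷ ((λ ()) ∷ [])
               ∷ []
               ∷ []

∈-allDirs : ∀ d → d ∈ allDirs
∈-allDirs right = here refl
∈-allDirs left  = there (here refl)
∈-allDirs up    = there (there (here refl))
∈-allDirs down  = there (there (there (here refl)))

movesOf-as-product : ∀ S → movesOf S ≡ filter (inD? S) (cartesianProduct (cells S) allDirs)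
movesOf-as-product S = cong (filter (inD? S)) (pairs (cells S))
  where
  pairs : ∀ Ps → concatMap (λ P → map (λ d → (P , d)) allDirs) Ps
                 ≡ cartesianProduct Ps allDirs
  pairs []       = refl
  pairs (P ∷ Ps) = cong (map (P ,_) allDirs ++_) (pairs Ps)

movesOf-unique : ∀ S → Unique (movesOf S)
movesOf-unique S rewrite movesOf-as-product S =
  filter⁺ (inD? S) (cartesianProduct⁺ (unique S) allDirs-unique)

∈-movesOf : ∀ S g → InD S g → g ∈ movesOf S
∈-movesOf S (P , d) inD rewrite movesOf-as-product S =
  ∈-filter⁺ (inD? S) (∈-cartesianProduct⁺ (proj₁ inD) (∈-allDirs d)) inD

sumD-supported : ∀ S h (f : Move → ℕ) → InD S h → (∀ g → h ≢ g → f g ≡ 0) → sumD S f ≡ f h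
sumD-supported S h f inD = sum-map-supported f (movesOf-unique S) (∈-movesOf S h inD)

-- hit h φ is the indicator of the single move h, cut down to the moves satisfying φ;
-- one occurrence of h in a succession contributes exactly this to a count.
hit : Move → (Move → Bool) → Move → ℕ
hit h φ g = bit (⌊ h ≟M g ⌋ ∧ φ g)

sumD-hit : ∀ S h φ → InD S h → sumD S (hit h φ) ≡ bit (φ h)
sumD-hit S h φ inD = trans (sumD-supported S h (hit h φ) inD off) at-h
  where
  off : ∀ g → h ≢ g → hit h φ g ≡ 0
  off g h≢g with h ≟M g
  ... | yes h≡g = ⊥-elim (h≢g h≡g)
  ... | no _    = refl
  at-h : hit h φ h ≡ bit (φ h)
  at-h with h ≟M h
  ... | yes _ = refl
  ... | no ne = ⊥-elim (ne refl)

-- x(𝔤) restricted to the moves satisfying φ; both sums Σ_{𝔤(A) ≠ 0} x(𝔤) and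
-- Σ_{𝔤(A)𝔤(A') ≠ 0} x(𝔤) are sums of such functions.
xcountOn : (Move → Bool) → List Move → Move → ℕ
xcountOn φ F g = if φ g then xcount F g else 0

xcountOn-step : ∀ φ h hs g → xcountOn φ (h ∷ hs) g ≡ hit h φ g N.+ xcountOn φ hs g
xcountOn-step φ h hs g with φ g | h ≟M g
... | true  | yes _ = refl
... | true  | no _  = refl
... | false | yes _ = refl
... | false | no _  = refl

xcountOn-nil : ∀ φ g → xcountOn φ [] g ≡ 0
xcountOn-nil φ g with φ g
... | true  = refl
... | false = refl

sumX-nil : ∀ S φ → sumD S (xcountOn φ []) ≡ 0
sumX-nil S φ = sum-map-zero (xcountOn φ []) {movesOf S} (All.tabulate (λ {g} _ → xcountOn-nil φ g))

sumX-step : ∀ S φ h hs → InD S h →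
  sumD S (xcountOn φ (h ∷ hs)) ≡ bit (φ h) N.+ sumD S (xcountOn φ hs)
sumX-step S φ h hs inD = begin
  sumD S (xcountOn φ (h ∷ hs))
    ≡⟨ cong sum (map-cong (xcountOn-step φ h hs) (movesOf S)) ⟩
  sum (map (λ g → hit h φ g N.+ xcountOn φ hs g) (movesOf S))
    ≡⟨ sum-map-+ (hit h φ) (xcountOn φ hs) (movesOf S) ⟩
  sumD S (hit h φ) N.+ sumD S (xcountOn φ hs)
    ≡⟨ cong (N._+ sumD S (xcountOn φ hs)) (sumD-hit S h φ inD) ⟩
  bit (φ h) N.+ sumD S (xcountOn φ hs) ∎
  where open ≡-Reasoning

sumY : Board → Position → List Move → Point → ℕ
sumY S K F X = sumD S (λ g → ycount K F g X)

sumY-nil : ∀ S K X → sumY S K [] X ≡ 0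
sumY-nil S K X = sum-map-zero (λ g → ycount K [] g X) {movesOf S} (All.tabulate (λ _ → refl))

sumY-step : ∀ S K h hs X → InD S h →
  sumY S K (h ∷ hs) X ≡ bit (⌊ mval h X Z.≟ + 0 ⌋ ∧ K X) N.+ sumY S (apply h K) hs X
sumY-step S K h hs X inD =
  trans (sum-map-+ (hit h vanishes-on-occupied) (λ g → ycount (apply h K) hs g X) (movesOf S))
        (cong (N._+ sumY S (apply h K) hs X) (sumD-hit S h vanishes-on-occupied inD))
  where
  vanishes-on-occupied : Move → Bool
  vanishes-on-occupied g = ⌊ mval g X Z.≟ + 0 ⌋ ∧ K X

contribution : Position → Move → Point → ℕ
contribution K g X = bit (⌊ mval g X Z.≟ + 0 ⌋ ∧ K X) N.+ bit (nonzero (mval g X))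

pfun-nil : ∀ S K X → pfun S K [] X ≡ 0
pfun-nil S K X = cong₂ N._+_ (sumY-nil S K X) (sumX-nil S (λ g → nonzero (mval g X)))

pfun-step : ∀ S K h hs X → InD S h →
  pfun S K (h ∷ hs) X ≡ contribution K h X N.+ pfun S (apply h K) hs X
pfun-step S K h hs X inD = begin
  sumY S K (h ∷ hs) X N.+ sumD S (xcountOn nonzeroAt (h ∷ hs))
    ≡⟨ cong₂ N._+_ (sumY-step S K h hs X inD) (sumX-step S nonzeroAt h hs inD) ⟩
  (y N.+ sumY S (apply h K) hs X) N.+ (x N.+ sumD S (xcountOn nonzeroAt hs))
    ≡⟨ interchange y _ x _ ⟩
  (y N.+ x) N.+ pfun S (apply h K) hs X ∎
  where
  open ≡-Reasoning
  nonzeroAt : Move → Bool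
  nonzeroAt g = nonzero (mval g X)
  y x : ℕ
  y = bit (⌊ mval h X Z.≟ + 0 ⌋ ∧ K X)
  x = bit (nonzero (mval h X))

crossSum-step : ∀ S h hs A A' → InD S h →
  crossSum S (h ∷ hs) A A' ≡ bit (nonzero (mval h A Z.* mval h A')) N.+ crossSum S hs A A'
crossSum-step S h hs A A' = sumX-step S (λ g → nonzero (mval g A Z.* mval g A')) h hs

height-swap : ∀ {S A A' K} → HeightInfinite S A A' K → HeightInfinite S A' A K
height-swap H F K s = H F K s ∘ Product.swap

height-step : ∀ {S A A' K} g → LegalMove S K g → HeightInfinite S A A' K →
  HeightInfinite S A A' (apply g K)
height-step g leg H F K s = H (g ∷ F) K (step leg s)

-- If g acts at X but not at Y, then Y is empty in K: otherwise X and Y would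
-- both be occupied, before the move when X ∈ {P, Q}, right after it when X = R.
partner-empty : ∀ {S K} g {X Y} → LegalMove S K g → HeightInfinite S X Y K →
  mval g X ≢ + 0 → mval g Y ≡ + 0 → K Y ≡ false
partner-empty {S} {K} g {X} {Y} leg H nzX zY = ¬-not (occupied⇒both (nonzero⇒touches g X nzX))
  where
  occupied⇒both : Touches g X → K Y ≢ true
  occupied⇒both (inj₁ refl)        kY = H [] K done (proj₁ (proj₂ leg) , kY)
  occupied⇒both (inj₂ (inj₁ refl)) kY = H [] K done (proj₁ (proj₂ (proj₂ leg)) , kY)
  occupied⇒both (inj₂ (inj₂ refl)) kY =
    H (g ∷ []) (apply g K) (step leg done) (landing-occupied g K , trans (zero⇒unchanged g K Y zY) kY)

contribution-zero : ∀ K g X → mval g X ≡ + 0 → contribution K g X ≡ bit (K X)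
contribution-zero K g X z rewrite z = NP.+-identityʳ (bit (K X))

contribution-nonzero : ∀ K g X → mval g X ≢ + 0 → contribution K g X ≡ 1
contribution-nonzero K g X nz with mval g X Z.≟ + 0
... | yes z = ⊥-elim (nz z)
... | no _  = refl

cross-nonzero : ∀ g A A' → mval g A ≢ + 0 → mval g A' ≢ + 0 →
  bit (nonzero (mval g A Z.* mval g A')) ≡ 1
cross-nonzero g A A' nzA nzA' with mval g A Z.* mval g A' Z.≟ + 0
... | no _  = refl
... | yes z with ZP.i*j≡0⇒i≡0∨j≡0 (mval g A) z
...   | inj₁ zA  = ⊥-elim (nzA zA)
...   | inj₂ zA' = ⊥-elim (nzA' zA')

at-most-one-occupied : ∀ a b → ¬ (a ≡ true × b ≡ true) → bit a N.+ bit b N.≤ 1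
at-most-one-occupied true  true  notBoth = ⊥-elim (notBoth (refl , refl))
at-most-one-occupied true  false _ = NP.≤-refl
at-most-one-occupied false true  _ = NP.≤-refl
at-most-one-occupied false false _ = N.z≤n

move-bound : ∀ {S K} g {A A'} → LegalMove S K g → HeightInfinite S A A' K →
  contribution K g A N.+ contribution K g A' N.≤ bit (nonzero (mval g A Z.* mval g A')) N.+ 1
move-bound {S} {K} g {A} {A'} leg H = by-cases (mval g A Z.≟ + 0) (mval g A' Z.≟ + 0)
  where
  cross : ℕ
  cross = bit (nonzero (mval g A Z.* mval g A'))
  by-cases : Dec (mval g A ≡ + 0) → Dec (mval g A' ≡ + 0) →
    contribution K g A N.+ contribution K g A' N.≤ cross N.+ 1
  by-cases (yes zA) (yes zA')
    rewrite contribution-zero K g A zA | contribution-zero K g A' zA' =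
    NP.≤-trans (at-most-one-occupied (K A) (K A') (H [] K done)) (NP.m≤n+m 1 cross)
  by-cases (yes zA) (no nzA')
    rewrite contribution-zero K g A zA | contribution-nonzero K g A' nzA'
          | partner-empty g leg (height-swap H) nzA' zA = NP.m≤n+m 1 cross
  by-cases (no nzA) (yes zA')
    rewrite contribution-nonzero K g A nzA | contribution-zero K g A' zA'
          | partner-empty g leg H nzA zA' = NP.m≤n+m 1 cross
  by-cases (no nzA) (no nzA')
    rewrite contribution-nonzero K g A nzA | contribution-nonzero K g A' nzA'
          | cross-nonzero g A A' nzA nzA' = NP.≤-refl

potential-bound : ∀ {S K F J} A A' → Succession S K F J → HeightInfinite S A A' K →
  pfun S K F A N.+ pfun S K F A' N.+ card S J N.≤ crossSum S F A A' N.+ card S K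
potential-bound {S} {K} A A' done H
  rewrite pfun-nil S K A | pfun-nil S K A' = NP.m≤n+m (card S K) _
potential-bound {S} {K} {g ∷ gs} {J} A A' (step leg rest) H
  rewrite pfun-step S K g gs A (proj₁ leg) | pfun-step S K g gs A' (proj₁ leg)
        | crossSum-step S g gs A A' (proj₁ leg) | sym (card-step S K g leg) = begin
  (tA N.+ pA) N.+ (tA' N.+ pA') N.+ card S J
    ≡⟨ cong (N._+ card S J) (interchange tA pA tA' pA') ⟩
  (tA N.+ tA') N.+ (pA N.+ pA') N.+ card S J
    ≡⟨ NP.+-assoc (tA N.+ tA') (pA N.+ pA') (card S J) ⟩
  (tA N.+ tA') N.+ (pA N.+ pA' N.+ card S J)
    ≤⟨ NP.+-mono-≤ (move-bound g leg H) (potential-bound A A' rest (height-step g leg H)) ⟩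
  (c N.+ 1) N.+ (crossSum S gs A A' N.+ card S K')
    ≡⟨ interchange c 1 (crossSum S gs A A') (card S K') ⟩
  (c N.+ crossSum S gs A A') N.+ (1 N.+ card S K')
    ≡⟨ cong ((c N.+ crossSum S gs A A') N.+_) (NP.+-comm 1 (card S K')) ⟩
  (c N.+ crossSum S gs A A') N.+ (card S K' N.+ 1) ∎
  where
  open NP.≤-Reasoning
  K' : Position
  K' = apply g K
  tA tA' pA pA' c : ℕ
  tA  = contribution K g A
  tA' = contribution K g A'
  pA  = pfun S K' gs A
  pA' = pfun S K' gs A'
  c   = bit (nonzero (mval g A Z.* mval g A'))

ℕ-ineq⇒ℤ-difference : ∀ a b c d → a N.+ d N.≤ b N.+ c → + a - + b ≤ + c - + d
ℕ-ineq⇒ℤ-difference a b c d a+d≤b+c = begin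
  + a - + b                     ≡⟨ add-d (+ a) (+ b) (+ d) ⟩
  (+ a Z.+ + d) - (+ d Z.+ + b) ≤⟨ ZP.+-monoˡ-≤ (Z.- (+ d Z.+ + b)) (Z.+≤+ a+d≤b+c) ⟩
  (+ b Z.+ + c) - (+ d Z.+ + b) ≡⟨ cancel-b (+ b) (+ c) (+ d) ⟩
  + c - + d                     ∎
  where
  open ZP.≤-Reasoning
  open ZS.+-*-Solver
  add-d : ∀ x y w → x - y ≡ (x Z.+ w) - (w Z.+ y)
  add-d = solve 3 (λ x y w → x :- y := (x :+ w) :- (w :+ y)) refl
  cancel-b : ∀ y z w → (y Z.+ z) - (w Z.+ y) ≡ z - w
  cancel-b = solve 3 (λ y z w → (y :+ z) :- (w :+ y) := z :- w) refl

lemma4 : (S : Board) (I J : Position) (F : List Move) →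
    I ⊆B S → J ⊆B S → Succession S I F J →
    (A A' : Point) → A ∈ cells S → A' ∈ cells S →
    HeightInfinite S A A' I →
    ((+ pfun S I F A) Data.Integer.+ (+ pfun S I F A')) - (+ crossSum S F A A')
      ≤ (+ card S I) - (+ card S J)
lemma4 S I J F _ _ succession A A' _ _ H =
  ℕ-ineq⇒ℤ-difference (pfun S I F A N.+ pfun S I F A') (crossSum S F A A') (card S I) (card S J)
    (potential-bound A A' succession H)
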